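{- Let $\Pi$ be a linear $m$-scheme on $S\subseteq V$, $t\in[m-1]$ and $x=(x_1,\dots,x_t)\in S^t$. Then $\Pi_x$ is a linear $(m-t)$-scheme on $S$. Moreover, if $\Pi$ is strongly antisymmetric, so is $\Pi_x$.
   Context: $V$ is a finite-dimensional vector space over a finite field $\mathbb{F}$. $\mathcal{M}_{k,k'}$ is the set of maps $V^k\to V^{k'}$, $(x_1,\dots,x_k)\mapsto(\sum_i c_{i,1}x_i,\dots,\sum_i c_{i,k'}x_i)$, $c_{i,j}\in\mathbb{F}$. A linear $m$-scheme on $S$ is $\Pi=\{\Pi^{(1)},\dots,\Pi^{(m)}\}$ with $\Pi^{(k)}$ a partition of $S^k$ such that for all $k,k'\in[m]$, $B\in\Pi^{(k)}$, $B'\in\Pi^{(k')}$, $\tau\in\mathcal{M}_{k,k'}$: (P1) $\tau(B)=B'$ or $\tau(B)\cap B'=\emptyset$; (P2) $\#\{x\in B:\tau(x)=y\}$ is constant for $y\in B'$. $\mathcal{M}_\Pi$ is the set of restrictions $\tau|_B:B\to B'$ with $B\in\Pi^{(k)}$, $B'\in\Pi^{(k')}$, $\tau\in\mathcal{M}_{k,k'}$ mapping $B$ bijectively onto $B'$; $\widetilde{\mathcal{M}}_\Pi$ is the set of all compositions of such maps and their inverses; $\Pi$ is strongly antisymmetric if $\widetilde{\mathcal{M}}_\Pi$ contains no nontrivial permutation of any block $B\in\Pi^{(k)}$, $k\in[m]$. $\Pi_x=\{\Pi_x^{(1)},\dots,\Pi_x^{(m-t)}\}$ where for $k\in[m-t]$,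 $y,z\in S^k$ are in the same block of $\Pi_x^{(k)}$ iff $(x,y),(x,z)\in S^{t+k}$ are in the same block of $\Pi^{(t+k)}$. -}

module Defs where

open import Data.Nat using (ℕ; _≤_) renaming (_+_ to _+ℕ_)
open import Data.Fin using (Fin)
open import Data.Vec using (Vec; []; _∷_; zipWith; map; replicate; tabulate; lookup; _++_)
open import Data.Vec.Relation.Unary.All using (All)
open import Data.Product using (Σ; _×_; _,_; proj₁; proj₂)
open import Data.Sum using (_⊎_)
open import Relation.Nullary using (¬_)
open import Relation.Binary.PropositionalEquality using (_≡_; _≢_)
open import Relation.Binary.Definitions using (DecidableEquality)
open import Algebra.Core using (Op₁; Op₂)
open import Algebra.Structures using (IsCommutativeRing)
open import Function.Bundles using (_↔_)

record FiniteField : Set₁ where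
  field
    Carrier           : Set
    _+_ _*_           : Op₂ Carrier
    -_                : Op₁ Carrier
    0# 1#             : Carrier
    isCommutativeRing : IsCommutativeRing _≡_ _+_ _*_ -_ 0# 1#
    0≢1               : 0# ≢ 1#
    inverse           : ∀ x → x ≢ 0# → Σ Carrier (λ y → x * y ≡ 1#)
    _≟_               : DecidableEquality Carrier
    size              : ℕ
    enum              : Carrier ↔ Fin size

module Scheme (F : FiniteField) (n : ℕ) where
  open FiniteField F

  V : Set
  V = Vec Carrier n

  _+ᵥ_ : V → V → V
  _+ᵥ_ = zipWith _+_

  _·ᵥ_ : Carrier → V → V
  c ·ᵥ v = map (c *_) v

  0ᵥ : V
  0ᵥ = replicate n 0#

  vsum : ∀ {k} → Vec V k → V
  vsum []       = 0ᵥ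
  vsum (v ∷ vs) = v +ᵥ vsum vs

  Subset : Set₁
  Subset = V → Set

  Tuple : ℕ → Set
  Tuple k = Vec V k

  -- coefficients c_{i,j} of a map τ ∈ M_{k,k'}
  Coeffs : ℕ → ℕ → Set
  Coeffs k k' = Fin k → Fin k' → Carrier

  τ : ∀ {k k'} → Coeffs k k' → Tuple k → Tuple k'
  τ {k} c xs = tabulate (λ j → vsum (tabulate (λ i → c i j ·ᵥ lookup xs i)))

  -- a partition of S^k, given as the relation "in the same block"
  -- (an equivalence relation on S^k, proof-irrelevant, relating only elements of S^k);
  -- the blocks are the classes [y] = {z ∣ R y z} with R y y.
  record IsPartition (S : Subset) (k : ℕ) (R : Tuple k → Tuple k → Set) : Set where
    field
      irrelevant : ∀ {y z} (p q : R y z) → p ≡ q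
      support    : ∀ {y z} → R y z → All S y × All S z
      refl       : ∀ {y} → All S y → R y y
      sym        : ∀ {y z} → R y z → R z y
      trans      : ∀ {x y z} → R x y → R y z → R x z

  -- a family (Π^(k))_k of block relations; only k ∈ [m] matters
  Family : Set₁
  Family = (k : ℕ) → Tuple k → Tuple k → Set

  InRange : ℕ → ℕ → Set
  InRange m k = 1 ≤ k × k ≤ m

  ImageEq : Family → ∀ {k k'} → Coeffs k k' → Tuple k → Tuple k' → Set
  ImageEq Π {k} {k'} c y y' =
    (∀ z → Π k y z → Π k' y' (τ c z)) ×
    (∀ w → Π k' y' w → Σ (Tuple k) (λ z → Π k y z × τ c z ≡ w))

  Disjoint : Family → ∀ {k k'} → Coeffs k k' → Tuple k → Tuple k' → Set
  Disjoint Π {k} {k'} c y y' = ∀ z → Π k y z → ¬ Π k' y' (τ c z)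

  Fibre : Family → ∀ {k k'} → Coeffs k k' → Tuple k → Tuple k' → Set
  Fibre Π {k} c y w = Σ (Tuple k) (λ z → Π k y z × τ c z ≡ w)

  record IsLinearScheme (m : ℕ) (S : Subset) (Π : Family) : Set where
    field
      partition : ∀ k → InRange m k → IsPartition S k (Π k)
      P1 : ∀ k k' → InRange m k → InRange m k' → (c : Coeffs k k')
           (y : Tuple k) (y' : Tuple k') → Π k y y → Π k' y' y' →
           ImageEq Π c y y' ⊎ Disjoint Π c y y'
      P2 : ∀ k k' → InRange m k → InRange m k' → (c : Coeffs k k')
           (y : Tuple k) (y' : Tuple k') → Π k y y → Π k' y' y' →
           Σ ℕ (λ N → ∀ w → Π k' y' w → Fibre Π c y w ↔ Fin N)

  restrict : ∀ {t} → Tuple t → Family → Family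
  restrict {t} x Π k y z = Π (t +ℕ k) (x ++ y) (x ++ z)

  record BijOnto (Π : Family) {k k'} (c : Coeffs k k') (y : Tuple k) (y' : Tuple k') : Set where
    field
      into : ∀ z → Π k y z → Π k' y' (τ c z)
      inj  : ∀ z z' → Π k y z → Π k y z' → τ c z ≡ τ c z' → z ≡ z'
      surj : ∀ w → Π k' y' w → Σ (Tuple k) (λ z → Π k y z × τ c z ≡ w)

  -- generators of M̃_Π: elements τ|_B of M_Π and their inverses,
  -- between blocks [y] ∈ Π^(k) and [y'] ∈ Π^(k')
  data Gen (Π : Family) (m : ℕ) : (k : ℕ) → Tuple k → (k' : ℕ) → Tuple k' → Set where
    fwd : ∀ {k k'} {y : Tuple k} {y' : Tuple k'} → InRange m k → InRange m k' →
          Π k y y → Π k' y' y' → (c : Coeffs k k') → BijOnto Π c y y' → Gen Π m k y k' y'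
    bwd : ∀ {k k'} {y : Tuple k} {y' : Tuple k'} → InRange m k → InRange m k' →
          Π k y y → Π k' y' y' → (c : Coeffs k' k) → BijOnto Π c y' y → Gen Π m k y k' y'

  data Chain (Π : Family) (m : ℕ) : (k : ℕ) → Tuple k → (k' : ℕ) → Tuple k' → Set where
    one : ∀ {k k'} {y : Tuple k} {y' : Tuple k'} → Gen Π m k y k' y' → Chain Π m k y k' y'
    _∷_ : ∀ {k k' k''} {y : Tuple k} {y' : Tuple k'} {y'' : Tuple k''} →
          Gen Π m k y k' y' → Chain Π m k' y' k'' y'' → Chain Π m k y k'' y''

  applyGen : ∀ {Π m k k'} {y : Tuple k} {y' : Tuple k'} → Gen Π m k y k' y' →
             (z : Tuple k) → Π k y z → Σ (Tuple k') (λ w → Π k' y' w)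
  applyGen (fwd _ _ _ _ c b) z p = τ c z , BijOnto.into b z p
  applyGen (bwd _ _ _ _ c b) z p =
    let r = BijOnto.surj b z p in proj₁ r , proj₁ (proj₂ r)

  -- the composite map (first generator applied first)
  applyChain : ∀ {Π m k k'} {y : Tuple k} {y' : Tuple k'} → Chain Π m k y k' y' →
               (z : Tuple k) → Π k y z → Σ (Tuple k') (λ w → Π k' y' w)
  applyChain (one g) z p = applyGen g z p
  applyChain (g ∷ f) z p =
    let r = applyGen g z p in applyChain f (proj₁ r) (proj₂ r)

  StronglyAntisymmetric : ℕ → Family → Set
  StronglyAntisymmetric m Π =
    ∀ k (y y' : Tuple k) (f : Chain Π m k y k y') → Π k y y' →
    ∀ z (p : Π k y z) → proj₁ (applyChain f z p) ≡ z

{-# OPTIONS --safe #-}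
module Submission where

-- Π_x is Π seen through the embedding y ↦ (x, y) of S^k into S^(t+k), and a
-- map τ ∈ M_{k,k'} corresponds to diag(1_t, τ) ∈ M_{t+k,t+k'}, which fixes the
-- prefix x.  Every preimage of (x, w) under diag(1_t, τ) again starts with x, so
-- images, disjointness and fibres of τ on blocks of Π_x are those of
-- diag(1_t, τ) on the corresponding blocks of Π; this gives (P1) and (P2).
-- For strong antisymmetry, a bijection τ between blocks of Π_x lifts to a
-- bijection diag(1_t, τ) between blocks of Π: it is onto by (P1), and injective
-- because by (P2) all its fibres are as large as the fibre over the image of
-- (x, y), which is a single point.  Hence every element of M̃_{Π_x} lifts to an
-- element of M̃_Π acting as (x, z) ↦ (x, f z), and a nontrivial permutation of a
-- block of Π_x would lift to one of a block of Π.

open import Defs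
open import Data.Nat using (ℕ; zero; suc; _≤_; _∸_) renaming (_+_ to _+ℕ_)
open import Data.Nat.Properties using (≤-trans; ≤-reflexive; m≤n+m; +-monoʳ-≤; m+[n∸m]≡n; m∸n≤m)
open import Data.Fin using (Fin; zero; suc)
open import Data.Product using (_×_; Σ; _,_; proj₁; proj₂)
open import Data.Sum using (_⊎_; inj₁; inj₂) renaming (map to map-⊎)
open import Data.Empty using (⊥-elim)
open import Data.Vec using ([]; _∷_; _++_; splitAt; tabulate; lookup)
open import Data.Vec.Properties
  using (map-cong; map-const; map-id; zipWith-replicate₁; zipWith-replicate₂;
         tabulate-cong; ++-injectiveˡ; ++-injectiveʳ; ≡-dec)
open import Data.Vec.Relation.Unary.All using (All)
open import Data.Vec.Relation.Unary.All.Properties using (++⁺; ++⁻)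
open import Relation.Nullary using (Irrelevant)
open import Relation.Binary.PropositionalEquality
  using (_≡_; refl; sym; trans; cong; cong₂; subst; module ≡-Reasoning)
open import Algebra.Structures using (IsCommutativeRing)
open import Function.Bundles using (_↔_; Inverse; mk↔ₛ′)
open import Function.Properties.Inverse using (↔-sym; ↔-trans)
open import Axiom.UniquenessOfIdentityProofs using (module Decidable⇒UIP)

↔-irrelevant : ∀ {a b} {A : Set a} {B : Set b} → A ↔ B → Irrelevant A → Irrelevant B
↔-irrelevant A↔B irrA u v = begin
  u                 ≡⟨ sym (strictlyInverseˡ u) ⟩
  to (from u)       ≡⟨ cong to (irrA (from u) (from v)) ⟩
  to (from v)       ≡⟨ strictlyInverseˡ v ⟩
  v                 ∎
  where open Inverse A↔B
        open ≡-Reasoning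

module BlockDiagonal (F : FiniteField) (n : ℕ) where
  open FiniteField F
  open Scheme F n
  open IsCommutativeRing isCommutativeRing using (zeroˡ; *-identityˡ; +-identityˡ; +-identityʳ)
  open ≡-Reasoning

  0·ᵥ : ∀ v → 0# ·ᵥ v ≡ 0ᵥ
  0·ᵥ v = trans (map-cong zeroˡ v) (map-const v 0#)

  1·ᵥ : ∀ v → 1# ·ᵥ v ≡ v
  1·ᵥ v = trans (map-cong *-identityˡ v) (map-id v)

  +ᵥ-identityˡ : ∀ v → 0ᵥ +ᵥ v ≡ v
  +ᵥ-identityˡ v = trans (zipWith-replicate₁ _+_ 0# v) (trans (map-cong +-identityˡ v) (map-id v))

  +ᵥ-identityʳ : ∀ v → v +ᵥ 0ᵥ ≡ v
  +ᵥ-identityʳ v = trans (zipWith-replicate₂ _+_ v 0#) (trans (map-cong +-identityʳ v) (map-id v))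

  vsum-0·ᵥ : ∀ {k} (vs : Fin k → V) → vsum (tabulate (λ i → 0# ·ᵥ vs i)) ≡ 0ᵥ
  vsum-0·ᵥ {zero}  vs = refl
  vsum-0·ᵥ {suc k} vs = begin
    (0# ·ᵥ vs zero) +ᵥ vsum (tabulate (λ i → 0# ·ᵥ vs (suc i)))
      ≡⟨ cong₂ _+ᵥ_ (0·ᵥ (vs zero)) (vsum-0·ᵥ (λ i → vs (suc i))) ⟩
    0ᵥ +ᵥ 0ᵥ
      ≡⟨ +ᵥ-identityʳ 0ᵥ ⟩
    0ᵥ ∎

  id⊕ : ∀ t {k k'} → Coeffs k k' → Coeffs (t +ℕ k) (t +ℕ k')
  id⊕ zero    c               = c
  id⊕ (suc t) c zero    zero    = 1#
  id⊕ (suc t) c zero    (suc j) = 0#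
  id⊕ (suc t) c (suc i) zero    = 0#
  id⊕ (suc t) c (suc i) (suc j) = id⊕ t c i j

  τ-id⊕-∷ : ∀ t {k k'} (c : Coeffs k k') (a : V) (w : Tuple (t +ℕ k)) →
            τ (id⊕ (suc t) c) (a ∷ w) ≡ a ∷ τ (id⊕ t c) w
  τ-id⊕-∷ t c a w = cong₂ _∷_ head (tabulate-cong tail)
    where
    head : (1# ·ᵥ a) +ᵥ vsum (tabulate (λ i → 0# ·ᵥ lookup w i)) ≡ a
    head = begin
      (1# ·ᵥ a) +ᵥ vsum (tabulate (λ i → 0# ·ᵥ lookup w i))
        ≡⟨ cong₂ _+ᵥ_ (1·ᵥ a) (vsum-0·ᵥ (lookup w)) ⟩
      a +ᵥ 0ᵥ
        ≡⟨ +ᵥ-identityʳ a ⟩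
      a ∎
    tail : ∀ j → (0# ·ᵥ a) +ᵥ vsum (tabulate (λ i → id⊕ t c i j ·ᵥ lookup w i))
               ≡ vsum (tabulate (λ i → id⊕ t c i j ·ᵥ lookup w i))
    tail j = trans (cong (_+ᵥ _) (0·ᵥ a)) (+ᵥ-identityˡ _)

  τ-id⊕-++ : ∀ t {k k'} (c : Coeffs k k') (a : Tuple t) (b : Tuple k) →
             τ (id⊕ t c) (a ++ b) ≡ a ++ τ c b
  τ-id⊕-++ zero    c []       b = refl
  τ-id⊕-++ (suc t) c (a ∷ as) b = trans (τ-id⊕-∷ t c a (as ++ b)) (cong (a ∷_) (τ-id⊕-++ t c as b))

  τ-id⊕-preimage : ∀ t {k k'} (c : Coeffs k k') (a : Tuple t) (w : Tuple k') (z : Tuple (t +ℕ k)) →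
                   τ (id⊕ t c) z ≡ a ++ w → Σ (Tuple k) (λ b → z ≡ a ++ b × τ c b ≡ w)
  τ-id⊕-preimage t c a w z eq with splitAt t z
  ... | a' , b , refl = b , cong (_++ b) (++-injectiveˡ a' a eq') , ++-injectiveʳ a' a eq'
    where eq' = trans (sym (τ-id⊕-++ t c a' b)) eq

module Fibres (F : FiniteField) (n : ℕ) where
  open FiniteField F
  open Scheme F n

  Tuple-≡-irrelevant : ∀ {k} {u v : Tuple k} → Irrelevant (u ≡ v)
  Tuple-≡-irrelevant = Decidable⇒UIP.≡-irrelevant (≡-dec (≡-dec _≟_))

  module _ (Π : Family) {k k'} (irr : ∀ {z z'} → Irrelevant (Π k z z'))
           (c : Coeffs k k') (y : Tuple k) where

    Fibre-≡ : ∀ {w} {u v : Fibre Π c y w} → proj₁ u ≡ proj₁ v → u ≡ v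
    Fibre-≡ {u = z , p , e} {v = .z , p' , e'} refl =
      cong₂ (λ p e → z , p , e) (irr p p') (Tuple-≡-irrelevant e e')

    injective-if-one-fibre-singleton :
      ∀ {y' : Tuple k'} {N} → (∀ w → Π k' y' w → Fibre Π c y w ↔ Fin N) →
      (∀ z → Π k y z → Π k' y' (τ c z)) →
      ∀ {w₀} → Π k' y' w₀ → (∀ (u v : Fibre Π c y w₀) → proj₁ u ≡ proj₁ v) →
      ∀ z z' → Π k y z → Π k y z' → τ c z ≡ τ c z' → z ≡ z'
    injective-if-one-fibre-singleton fibre↔Fin into w₀∈B' singleton z z' p p' e =
      cong proj₁ (fibre-irrelevant (z , p , refl) (z' , p' , sym e))
      where
      Fin-irrelevant : Irrelevant (Fin _)
      Fin-irrelevant = ↔-irrelevant (fibre↔Fin _ w₀∈B') (λ u v → Fibre-≡ (singleton u v))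
      fibre-irrelevant : Irrelevant (Fibre Π c y (τ c z))
      fibre-irrelevant = ↔-irrelevant (↔-sym (fibre↔Fin _ (into z p))) Fin-irrelevant

module Restriction (F : FiniteField) (n : ℕ) (Π : Scheme.Family F n)
                   {t} (x : Scheme.Tuple F n t) where
  open FiniteField F
  open Scheme F n
  open BlockDiagonal F n
  open Fibres F n

  Πₓ : Family
  Πₓ = restrict x Π

  restrict-isPartition : ∀ {S k} → All S x → IsPartition S (t +ℕ k) (Π (t +ℕ k)) →
                         IsPartition S k (Πₓ k)
  restrict-isPartition Sx P = record
    { irrelevant = P.irrelevant
    ; support    = λ p → let Sxy , Sxz = P.support p in proj₂ (++⁻ x Sxy) , proj₂ (++⁻ x Sxz)
    ; refl       = λ Sy → P.refl (++⁺ Sx Sy)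
    ; sym        = P.sym
    ; trans      = P.trans
    }
    where module P = IsPartition P

  module _ {k k'} {c : Coeffs k k'} {y : Tuple k} {y' : Tuple k'} where

    restrict-imageEq : ImageEq Π (id⊕ t c) (x ++ y) (x ++ y') → ImageEq Πₓ c y y'
    restrict-imageEq (into , onto) = intoₓ , ontoₓ
      where
      intoₓ : ∀ z → Πₓ k y z → Πₓ k' y' (τ c z)
      intoₓ z p = subst (Π _ (x ++ y')) (τ-id⊕-++ t c x z) (into (x ++ z) p)
      ontoₓ : ∀ w → Πₓ k' y' w → Σ (Tuple k) (λ z → Πₓ k y z × τ c z ≡ w)
      ontoₓ w q with onto (x ++ w) q
      ... | z , p , e with τ-id⊕-preimage t c x w z e
      ... | b , refl , e' = b , p , e'

    restrict-disjoint : Disjoint Π (id⊕ t c) (x ++ y) (x ++ y') → Disjoint Πₓ c y y'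
    restrict-disjoint disjoint z p q =
      disjoint (x ++ z) p (subst (Π _ (x ++ y')) (sym (τ-id⊕-++ t c x z)) q)

  restrict-Fibre↔ : ∀ {k k'} {c : Coeffs k k'} {y : Tuple k} {w : Tuple k'} →
    (∀ {z z'} → Irrelevant (Π (t +ℕ k) z z')) →
    Fibre Πₓ c y w ↔ Fibre Π (id⊕ t c) (x ++ y) (x ++ w)
  restrict-Fibre↔ {c = c} {y} {w} irr = mk↔ₛ′ to from to∘from from∘to
    where
    preimage : (u : Fibre Π (id⊕ t c) (x ++ y) (x ++ w)) →
               Σ (Tuple _) (λ b → proj₁ u ≡ x ++ b × τ c b ≡ w)
    preimage (z , _ , e) = τ-id⊕-preimage t c x w z e
    to : Fibre Πₓ c y w → Fibre Π (id⊕ t c) (x ++ y) (x ++ w)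
    to (z , p , e) = x ++ z , p , trans (τ-id⊕-++ t c x z) (cong (x ++_) e)
    from : Fibre Π (id⊕ t c) (x ++ y) (x ++ w) → Fibre Πₓ c y w
    from u@(_ , p , _) = let b , z≡xb , e = preimage u in b , subst (Π _ (x ++ y)) z≡xb p , e
    to∘from : ∀ u → to (from u) ≡ u
    to∘from u = Fibre-≡ Π irr (id⊕ t c) (x ++ y) (sym (proj₁ (proj₂ (preimage u))))
    from∘to : ∀ u → from (to u) ≡ u
    from∘to u = Fibre-≡ Πₓ irr c y (sym (++-injectiveʳ x x (proj₁ (proj₂ (preimage (to u))))))

  lift-BijOnto : ∀ {k k'} {c : Coeffs k k'} {y : Tuple k} {y' : Tuple k'} {N} →
    (∀ {z z'} → Irrelevant (Π (t +ℕ k) z z')) →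
    ImageEq Π (id⊕ t c) (x ++ y) (x ++ y') ⊎ Disjoint Π (id⊕ t c) (x ++ y) (x ++ y') →
    (∀ w → Π (t +ℕ k') (x ++ y') w → Fibre Π (id⊕ t c) (x ++ y) w ↔ Fin N) →
    Πₓ k y y → BijOnto Πₓ c y y' → BijOnto Π (id⊕ t c) (x ++ y) (x ++ y')
  lift-BijOnto {y = y} _ (inj₂ disjoint) _ y∈B bij =
    ⊥-elim (restrict-disjoint disjoint y y∈B (BijOnto.into bij y y∈B))
  lift-BijOnto {c = c} {y} irr (inj₁ (into , onto)) fibre↔Fin y∈B bij = record
    { into = into
    ; inj  = injective-if-one-fibre-singleton Π irr (id⊕ t c) (x ++ y) fibre↔Fin into (into (x ++ y) y∈B)
               (λ u v → trans (fibre-is-point u) (sym (fibre-is-point v)))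
    ; surj = onto
    }
    where
    fibre-is-point : (u : Fibre Π (id⊕ t c) (x ++ y) (τ (id⊕ t c) (x ++ y))) → proj₁ u ≡ x ++ y
    fibre-is-point (z , p , e) with τ-id⊕-preimage t c x (τ c y) z (trans e (τ-id⊕-++ t c x y))
    ... | b , refl , e' = cong (x ++_) (BijOnto.inj bij b y p y∈B e')

module RestrictedScheme (F : FiniteField) (n : ℕ) {m t} {S : Scheme.Subset F n}
                        {Π : Scheme.Family F n} (LS : Scheme.IsLinearScheme F n m S Π)
                        (t≤m : t ≤ m) {x : Scheme.Tuple F n t} (Sx : All S x) where
  open FiniteField F
  open Scheme F n
  open BlockDiagonal F n
  open Restriction F n Π x
  open IsLinearScheme LS

  embed-InRange : ∀ {k} → InRange (m ∸ t) k → InRange m (t +ℕ k)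
  embed-InRange {k} (1≤k , k≤m∸t) =
    ≤-trans 1≤k (m≤n+m k t) , ≤-trans (+-monoʳ-≤ t k≤m∸t) (≤-reflexive (m+[n∸m]≡n t≤m))

  irrelevant : ∀ {k} → InRange (m ∸ t) k → ∀ {z z'} → Irrelevant (Π (t +ℕ k) z z')
  irrelevant r = IsPartition.irrelevant (partition _ (embed-InRange r))

  isLinearScheme : IsLinearScheme (m ∸ t) S Πₓ
  isLinearScheme = record
    { partition = λ k r → restrict-isPartition Sx (partition _ (embed-InRange r))
    ; P1 = λ k k' r r' c y y' y∈B y'∈B' →
        map-⊎ restrict-imageEq restrict-disjoint
          (P1 _ _ (embed-InRange r) (embed-InRange r') (id⊕ t c) (x ++ y) (x ++ y') y∈B y'∈B')
    ; P2 = λ k k' r r' c y y' y∈B y'∈B' →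
        let N , fibre↔Fin = P2 _ _ (embed-InRange r) (embed-InRange r') (id⊕ t c)
                                 (x ++ y) (x ++ y') y∈B y'∈B'
        in N , λ w w∈B' → ↔-trans (restrict-Fibre↔ (irrelevant r)) (fibre↔Fin (x ++ w) w∈B')
    }

  lift-BijOnto′ : ∀ {k k'} → InRange (m ∸ t) k → InRange (m ∸ t) k' →
    {c : Coeffs k k'} {y : Tuple k} {y' : Tuple k'} → Πₓ k y y → Πₓ k' y' y' →
    BijOnto Πₓ c y y' → BijOnto Π (id⊕ t c) (x ++ y) (x ++ y')
  lift-BijOnto′ r r' {c} {y} {y'} y∈B y'∈B' =
    lift-BijOnto (irrelevant r) (P1 _ _ (embed-InRange r) (embed-InRange r') (id⊕ t c) _ _ y∈B y'∈B')
      (proj₂ (P2 _ _ (embed-InRange r) (embed-InRange r') (id⊕ t c) _ _ y∈B y'∈B')) y∈B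

  lift-Gen : ∀ {k k'} {y : Tuple k} {y' : Tuple k'} → Gen Πₓ (m ∸ t) k y k' y' →
             Gen Π m (t +ℕ k) (x ++ y) (t +ℕ k') (x ++ y')
  lift-Gen (fwd r r' y∈B y'∈B' c bij) =
    fwd (embed-InRange r) (embed-InRange r') y∈B y'∈B' (id⊕ t c) (lift-BijOnto′ r r' y∈B y'∈B' bij)
  lift-Gen (bwd r r' y∈B y'∈B' c bij) =
    bwd (embed-InRange r) (embed-InRange r') y∈B y'∈B' (id⊕ t c) (lift-BijOnto′ r' r y'∈B' y∈B bij)

  lift-Chain : ∀ {k k'} {y : Tuple k} {y' : Tuple k'} → Chain Πₓ (m ∸ t) k y k' y' →
               Chain Π m (t +ℕ k) (x ++ y) (t +ℕ k') (x ++ y')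
  lift-Chain (one g) = one (lift-Gen g)
  lift-Chain (g ∷ f) = lift-Gen g ∷ lift-Chain f

  applyGen-lift : ∀ {k k'} {y : Tuple k} {y' : Tuple k'} (g : Gen Πₓ (m ∸ t) k y k' y')
    {z : Tuple k} {z′ : Tuple (t +ℕ k)} (p : Πₓ k y z) (p′ : Π _ (x ++ y) z′) → z′ ≡ x ++ z →
    proj₁ (applyGen (lift-Gen g) z′ p′) ≡ x ++ proj₁ (applyGen g z p)
  applyGen-lift (fwd _ _ _ _ c _) {z} _ _ refl = τ-id⊕-++ t c x z
  applyGen-lift (bwd r r' y∈B y'∈B' c bij) {z} {z′} p p′ refl =
    BijOnto.inj lifted (proj₁ pre′) (x ++ proj₁ pre) (proj₁ (proj₂ pre′)) (proj₁ (proj₂ pre)) (begin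
      τ (id⊕ t c) (proj₁ pre′)    ≡⟨ proj₂ (proj₂ pre′) ⟩
      x ++ z                      ≡⟨ cong (x ++_) (sym (proj₂ (proj₂ pre))) ⟩
      x ++ τ c (proj₁ pre)        ≡⟨ sym (τ-id⊕-++ t c x (proj₁ pre)) ⟩
      τ (id⊕ t c) (x ++ proj₁ pre) ∎)
    where
    open ≡-Reasoning
    lifted = lift-BijOnto′ r' r y'∈B' y∈B bij
    pre′ = BijOnto.surj lifted z′ p′
    pre = BijOnto.surj bij z p

  applyChain-lift : ∀ {k k'} {y : Tuple k} {y' : Tuple k'} (f : Chain Πₓ (m ∸ t) k y k' y')
    {z : Tuple k} {z′ : Tuple (t +ℕ k)} (p : Πₓ k y z) (p′ : Π _ (x ++ y) z′) → z′ ≡ x ++ z →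
    proj₁ (applyChain (lift-Chain f) z′ p′) ≡ x ++ proj₁ (applyChain f z p)
  applyChain-lift (one g) p p′ e = applyGen-lift g p p′ e
  applyChain-lift (g ∷ f) p p′ e =
    applyChain-lift f (proj₂ (applyGen g _ p)) (proj₂ (applyGen (lift-Gen g) _ p′)) (applyGen-lift g p p′ e)

  stronglyAntisymmetric : StronglyAntisymmetric m Π → StronglyAntisymmetric (m ∸ t) Πₓ
  stronglyAntisymmetric sa k y y' f y'∈B z p = ++-injectiveʳ x x (begin
    x ++ proj₁ (applyChain f z p)                 ≡⟨ sym (applyChain-lift f p p refl) ⟩
    proj₁ (applyChain (lift-Chain f) (x ++ z) p)  ≡⟨ sa _ _ _ (lift-Chain f) y'∈B (x ++ z) p ⟩
    x ++ z                                        ∎)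
    where open ≡-Reasoning

lemma3p6 : (F : FiniteField) (n m t : ℕ) (S : Scheme.Subset F n) (Π : Scheme.Family F n) →
    Scheme.IsLinearScheme F n m S Π →
    1 ≤ t → t ≤ m ∸ 1 →
    (x : Scheme.Tuple F n t) → All S x →
    Scheme.IsLinearScheme F n (m ∸ t) S (Scheme.restrict F n x Π) ×
    (Scheme.StronglyAntisymmetric F n m Π →
      Scheme.StronglyAntisymmetric F n (m ∸ t) (Scheme.restrict F n x Π))
lemma3p6 F n m t S Π LS _ t≤m∸1 x Sx = isLinearScheme , stronglyAntisymmetric
  where open RestrictedScheme F n LS (≤-trans t≤m∸1 (m∸n≤m m 1)) Sx
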